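{- If $n=4t+2\ge10$, then $\zeta(G_n)=n(n+2)$.
   Context: $G_n=C_n\square P_2$ is the prism graph with vertex set $\{(t,i),(b,i): i\in\mathbb{Z}_n\}$, with $(t,i)$ adjacent to $(t,i\pm1)$ and $(b,i)$, and $(b,i)$ adjacent to $(b,i\pm1)$ and $(t,i)$. $\zeta(G)$ denotes the number of dominating sets of $G$ of minimum size $\gamma(G)$, counting distinct vertex subsets of the labeled graph separately. -}

module Defs where

open import Data.Bool using (Bool; true; false; T; not)
open import Data.Nat using (ℕ; zero; suc; _+_; _≟_)
open import Data.Fin using (Fin; toℕ)
open import Data.Fin.Subset using (Subset; _∈_; ∣_∣)
open import Data.Fin.Subset.Properties using (_∈?_)
open import Data.Fin.Properties using (all?; any?)
open import Data.Vec using (Vec; []; _∷_)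
open import Data.List using (List; []; _∷_; map; concatMap; filter; length)
open import Data.Product using (_×_; _,_; Σ; ∃; proj₁; proj₂)
open import Data.Sum using (_⊎_)
open import Relation.Nullary using (Dec; yes; no; ¬_)
open import Relation.Nullary.Decidable using (_×-dec_; _⊎-dec_)
open import Relation.Binary.PropositionalEquality using (_≡_)

sucMod : ℕ → ℕ → ℕ
sucMod n k with suc k ≟ n
... | yes _ = 0
... | no  _ = suc k

CycAdj : (n : ℕ) → Fin n → Fin n → Set
CycAdj n i j = (toℕ j ≡ sucMod n (toℕ i)) ⊎ (toℕ i ≡ sucMod n (toℕ j))

-- Vertices of the prism G_n = C_n □ P_2 :  (side , i), side true = t, false = b.
Vertex : ℕ → Set
Vertex n = Bool × Fin n

Adj : (n : ℕ) → Vertex n → Vertex n → Set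
Adj n (s , i) (s′ , j) = (s ≡ s′ × CycAdj n i j) ⊎ (s′ ≡ not s × i ≡ j)

VSet : ℕ → Set
VSet n = Subset n × Subset n

_∈V_ : ∀ {n} → Vertex n → VSet n → Set
(true  , i) ∈V (T , B) = i ∈ T
(false , i) ∈V (T , B) = i ∈ B

size : ∀ {n} → VSet n → ℕ
size (T , B) = ∣ T ∣ + ∣ B ∣

Dominating : (n : ℕ) → VSet n → Set
Dominating n S = ∀ (v : Vertex n) → v ∈V S ⊎ ∃ λ (u : Vertex n) → Adj n u v × u ∈V S

IsDominationNumber : (n : ℕ) → ℕ → Set
IsDominationNumber n k =
  (∃ λ (S : VSet n) → Dominating n S × size S ≡ k) ×
  (∀ (S : VSet n) → Dominating n S → k Data.Nat.≤ size S)

∈V? : ∀ {n} (v : Vertex n) (S : VSet n) → Dec (v ∈V S)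
∈V? (true  , i) (T , B) = i ∈? T
∈V? (false , i) (T , B) = i ∈? B

sucMod? : ∀ n (a b : ℕ) → Dec (a ≡ sucMod n b)
sucMod? n a b = a ≟ sucMod n b

CycAdj? : ∀ n (i j : Fin n) → Dec (CycAdj n i j)
CycAdj? n i j = sucMod? n (toℕ j) (toℕ i) ⊎-dec sucMod? n (toℕ i) (toℕ j)

bool≟ : (a b : Bool) → Dec (a ≡ b)
bool≟ = Data.Bool._≟_

fin≟ : ∀ {n} (i j : Fin n) → Dec (i ≡ j)
fin≟ = Data.Fin._≟_

Adj? : ∀ n (u v : Vertex n) → Dec (Adj n u v)
Adj? n (s , i) (s′ , j) = (bool≟ s s′ ×-dec CycAdj? n i j) ⊎-dec (bool≟ s′ (not s) ×-dec fin≟ i j)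

anyVertex? : ∀ {n} {P : Vertex n → Set} → (∀ v → Dec (P v)) → Dec (∃ P)
anyVertex? {n} {P} P? with any? (λ i → P? (true , i)) | any? (λ i → P? (false , i))
... | yes (i , p) | _ = yes ((true , i) , p)
... | no _ | yes (i , p) = yes ((false , i) , p)
... | no ¬t | no ¬b = no λ { ((true , i) , p) → ¬t (i , p) ; ((false , i) , p) → ¬b (i , p) }

allVertex? : ∀ {n} {P : Vertex n → Set} → (∀ v → Dec (P v)) → Dec (∀ v → P v)
allVertex? {n} {P} P? with all? (λ i → P? (true , i)) | all? (λ i → P? (false , i))
... | yes t | yes b = yes λ { (true , i) → t i ; (false , i) → b i }
... | no ¬t | _ = no λ f → ¬t (λ i → f (true , i))
... | yes _ | no ¬b = no λ f → ¬b (λ i → f (false , i))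

Dominating? : ∀ n (S : VSet n) → Dec (Dominating n S)
Dominating? n S = allVertex? λ v → ∈V? v S ⊎-dec anyVertex? (λ u → Adj? n u v ×-dec ∈V? u S)

allSubsets : ∀ m → List (Subset m)
allSubsets zero    = [] ∷ []
allSubsets (suc m) = map (false ∷_) (allSubsets m) Data.List.++ map (true ∷_) (allSubsets m)

allVSets : ∀ n → List (VSet n)
allVSets n = concatMap (λ T → map (T ,_) (allSubsets n)) (allSubsets n)

-- Number of dominating sets of G_n of size exactly k
-- (distinct vertex subsets of the labelled graph counted separately).
numDomSetsOfSize : ℕ → ℕ → ℕ
numDomSetsOfSize n k = length (filter (λ S → Dominating? n S ×-dec (size S ≟ k)) (allVSets n))

IsZeta : ℕ → ℕ → Set
IsZeta n z = ∃ λ k → IsDominationNumber n k × numDomSetsOfSize n k ≡ z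

{-# OPTIONS --safe #-}
module Submission where

-- Record a vertex set S of G_n = C_n □ P_2 as the cyclic word of its n columns (two membership bits
-- each). S dominates iff every window of three cyclically consecutive columns is admissible, so
-- dominating sets are closed walks of a transfer matrix on pairs of consecutive columns. A potential
-- φ on pairs of columns makes the local excess 2·|b| + φ(b,c) − 1 − φ(a,b) of an admissible window
-- (a,b,c) a natural number, and around the cycle the potentials telescope, so the excesses add up to
-- 2|S| − n. Weighting each window by x^excess in ℕ[x]/(x³), the trace of the n-step transfer counts
-- the dominating sets with 2|S| − n = 0, 1, 2 in its three coefficients. Finally, four transfer
-- steps act on the tables reached after eight steps like a unipotent Jordan block of size three
-- (checked by evaluation), so along n ≡ 2 (mod 4) the trace is a quadratic in n; it equals
-- n(n+2)·x².

open import Defs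

open import Algebra.Bundles using (CommutativeSemigroup)
open import Algebra.Core using (Op₂)
open import Algebra.Structures using (IsCommutativeSemigroup)
import Algebra.Properties.CommutativeSemigroup as CommutativeSemigroupProperties
open import Data.Bool using (Bool; true; false; T; not; _∧_; _∨_; if_then_else_)
open import Data.Bool.Properties using (T?; T-∧; T-∨; T-≡; not-involutive)
open import Data.Empty using (⊥-elim)
open import Data.Fin using (Fin; toℕ; fromℕ<; #_) renaming (zero to fzero; suc to fsuc)
open import Data.Fin.Properties using (toℕ<n; toℕ-fromℕ<)
open import Data.Fin.Subset using (Subset; _∈_; ∣_∣)
open import Data.List using (List; []; _∷_)
import Data.List as List
import Data.List.Properties as List
open import Data.List.Relation.Unary.All using ([]; _∷_)
open import Data.List.Relation.Unary.All.Properties using (all-filter)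
open import Data.Nat using (ℕ; zero; suc; _+_; _*_; _∸_; _≤_; _<_; _≤?_; _≟_; s≤s; z≤n)
open import Data.Nat.ListAction using () renaming (sum to sumˡ)
open import Data.Nat.ListAction.Properties using () renaming (sum-++ to sumˡ-++)
open import Data.Nat.Properties
  using ( +-assoc; +-comm; +-suc; +-identityʳ; +-cancelʳ-≡; +-monoˡ-≤; +-isCommutativeSemigroup
        ; *-cancelˡ-≡; *-cancelˡ-≤; m∸n+n≡m; suc-injective; 1+n≢0; n≤0⇒n≡0
        ; ≤-refl; ≤-trans; <-trans; <-irrefl; n<1+n; m≤m+n; m≤n+m; m≤n⇒m<n∨m≡n
        ; module ≤-Reasoning )
open import Data.Nat.Tactic.RingSolver using (solve-∀)
open import Data.Product using (_×_; _,_; proj₁; proj₂; ∃)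
open import Data.Sum using (_⊎_; inj₁; inj₂)
import Data.Sum as Sum
open import Data.Unit using (tt)
open import Data.Vec using (Vec; []; _∷_; _++_; zip; zipWith; replicate; lookup; map; sum)
open import Data.Vec.Properties
  using ( ≡-dec; zipWith-assoc; zipWith-comm; lookup-replicate; lookup-zip; lookup-zipWith
        ; map-++; sum-++; []=⇒lookup; lookup⇒[]= )
open import Function using (_∘_)
open import Function.Bundles using (Equivalence; _⇔_; mk⇔)
import Function.Properties.Equivalence as ⇔
open import Level using (0ℓ)
open import Relation.Binary.PropositionalEquality
  using (_≡_; _≢_; _≗_; refl; sym; trans; subst; cong; cong₂; isEquivalence; module ≡-Reasoning)
open import Relation.Nullary using (Dec; yes; no; ¬_; does)
open import Relation.Nullary.Decidable using (map′; _×-dec_; _→-dec_; from-yes)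
open import Relation.Unary using (Decidable)

private variable
  d m n : ℕ

-- Coefficient vectors of ℕ[x]/(xᵈ).
Trunc : ℕ → Set
Trunc d = Vec ℕ d

_⊕_ : Trunc d → Trunc d → Trunc d
_⊕_ = zipWith _+_

𝟘 : Trunc d
𝟘 = replicate _ 0

x^_ : ℕ → Trunc d
x^_ {zero}  _       = []
x^_ {suc d} zero    = 1 ∷ 𝟘
x^_ {suc d} (suc e) = 0 ∷ x^ e

pushIn : ℕ → Trunc d → Trunc d
pushIn a []      = []
pushIn a (b ∷ p) = a ∷ pushIn b p

shift : ℕ → Trunc d → Trunc d
shift zero    p = p
shift (suc e) p = shift e (pushIn 0 p)

⊕-isCommutativeSemigroup : IsCommutativeSemigroup _≡_ (_⊕_ {d})
⊕-isCommutativeSemigroup = record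
  { isSemigroup = record
    { isMagma = record { isEquivalence = isEquivalence ; ∙-cong = cong₂ _⊕_ }
    ; assoc   = zipWith-assoc +-assoc
    }
  ; comm = zipWith-comm +-comm
  }

pushIn-⊕ : ∀ a b (p q : Trunc d) → pushIn (a + b) (p ⊕ q) ≡ pushIn a p ⊕ pushIn b q
pushIn-⊕ a b []       []       = refl
pushIn-⊕ a b (p ∷ ps) (q ∷ qs) = cong (a + b ∷_) (pushIn-⊕ p q ps qs)

pushIn-𝟘 : pushIn 0 (𝟘 {d}) ≡ 𝟘
pushIn-𝟘 {zero}  = refl
pushIn-𝟘 {suc d} = cong (0 ∷_) pushIn-𝟘

pushIn-x^ : ∀ e → pushIn 0 (x^_ {d} e) ≡ x^ suc e
pushIn-x^ {zero}        e       = refl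
pushIn-x^ {suc zero}    zero    = refl
pushIn-x^ {suc (suc d)} zero    = cong (λ p → 0 ∷ 1 ∷ p) pushIn-𝟘
pushIn-x^ {suc d}       (suc e) = cong (0 ∷_) (pushIn-x^ e)

shift-⊕ : ∀ e (p q : Trunc d) → shift e (p ⊕ q) ≡ shift e p ⊕ shift e q
shift-⊕ zero    p q = refl
shift-⊕ (suc e) p q = trans (cong (shift e) (pushIn-⊕ 0 0 p q)) (shift-⊕ e (pushIn 0 p) (pushIn 0 q))

shift-𝟘 : ∀ e → shift e (𝟘 {d}) ≡ 𝟘
shift-𝟘 zero    = refl
shift-𝟘 (suc e) = trans (cong (shift e) pushIn-𝟘) (shift-𝟘 e)

shift-x^ : ∀ e f → shift e (x^_ {d} f) ≡ x^ (e + f)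
shift-x^ zero    f = refl
shift-x^ (suc e) f = begin
  shift e (pushIn 0 (x^ f)) ≡⟨ cong (shift e) (pushIn-x^ f) ⟩
  shift e (x^ suc f)        ≡⟨ shift-x^ e (suc f) ⟩
  x^ (e + suc f)            ≡⟨ cong x^_ (+-suc e f) ⟩
  x^ suc (e + f)            ∎
  where open ≡-Reasoning

lookup-x^-toℕ : (i : Fin d) → lookup (x^ toℕ i) i ≡ 1
lookup-x^-toℕ fzero    = refl
lookup-x^-toℕ (fsuc i) = lookup-x^-toℕ i

lookup-x^-≢ : (i : Fin d) {e : ℕ} → toℕ i ≢ e → lookup (x^ e) i ≡ 0
lookup-x^-≢ fzero    {zero}  i≢e = ⊥-elim (i≢e refl)
lookup-x^-≢ fzero    {suc e} _   = refl
lookup-x^-≢ (fsuc i) {zero}  _   = lookup-replicate i 0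
lookup-x^-≢ (fsuc i) {suc e} i≢e = lookup-x^-≢ i (i≢e ∘ cong suc)

Poly : Set
Poly = Trunc 3

-- The membership bits (top , bottom) of the two vertices (t,i), (b,i) of one rung of the prism.
Column : Set
Column = Bool × Bool

module Sums {A : Set} (_∙_ : Op₂ A) where

  Σᵇ : (Bool → A) → A
  Σᵇ f = f false ∙ f true

  Σᶜ : (Column → A) → A
  Σᶜ f = Σᵇ λ t → Σᵇ λ b → f (t , b)

  Σˢ : ∀ n → (Vec Bool n → A) → A
  Σˢ zero    f = f []
  Σˢ (suc n) f = Σᵇ λ t → Σˢ n λ p → f (t ∷ p)

  Σᵛ : ∀ n → (Vec Column n → A) → A
  Σᵛ zero    f = f []
  Σᵛ (suc n) f = Σᶜ λ c → Σᵛ n λ w → f (c ∷ w)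

  Σᶜ-cong : {f g : Column → A} → f ≗ g → Σᶜ f ≡ Σᶜ g
  Σᶜ-cong f≗g = cong₂ _∙_ (cong₂ _∙_ (f≗g _) (f≗g _)) (cong₂ _∙_ (f≗g _) (f≗g _))

  Σˢ-cong : ∀ n {f g : Vec Bool n → A} → f ≗ g → Σˢ n f ≡ Σˢ n g
  Σˢ-cong zero    f≗g = f≗g []
  Σˢ-cong (suc n) f≗g = cong₂ _∙_ (Σˢ-cong n (f≗g ∘ (false ∷_))) (Σˢ-cong n (f≗g ∘ (true ∷_)))

module SumLaws {A : Set} {_∙_ : Op₂ A} (isCS : IsCommutativeSemigroup _≡_ _∙_) where
  open Sums _∙_

  private
    commutativeSemigroup : CommutativeSemigroup 0ℓ 0ℓ
    commutativeSemigroup = record { isCommutativeSemigroup = isCS }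

  open CommutativeSemigroupProperties commutativeSemigroup using (interchange)

  Σᵇ-∙ : (f g : Bool → A) → Σᵇ (λ t → f t ∙ g t) ≡ Σᵇ f ∙ Σᵇ g
  Σᵇ-∙ f g = interchange _ _ _ _

  Σᶜ-∙ : (f g : Column → A) → Σᶜ (λ c → f c ∙ g c) ≡ Σᶜ f ∙ Σᶜ g
  Σᶜ-∙ f g = trans (cong₂ _∙_ (Σᵇ-∙ (λ b → f (false , b)) (λ b → g (false , b)))
                              (Σᵇ-∙ (λ b → f (true , b)) (λ b → g (true , b))))
                   (Σᵇ-∙ (λ t → Σᵇ λ b → f (t , b)) (λ t → Σᵇ λ b → g (t , b)))

  Σˢ-∙ : ∀ n (f g : Vec Bool n → A) → Σˢ n (λ p → f p ∙ g p) ≡ Σˢ n f ∙ Σˢ n g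
  Σˢ-∙ zero    f g = refl
  Σˢ-∙ (suc n) f g = trans (cong₂ _∙_ (Σˢ-∙ n _ _) (Σˢ-∙ n _ _))
                           (Σᵇ-∙ (λ t → Σˢ n (f ∘ (t ∷_))) (λ t → Σˢ n (g ∘ (t ∷_))))

  Σˢ-zip : ∀ n (g : Vec Column n → A) → Σˢ n (λ top → Σˢ n λ bot → g (zip top bot)) ≡ Σᵛ n g
  Σˢ-zip zero    g = refl
  Σˢ-zip (suc n) g = cong₂ _∙_ (swap false) (swap true)
    where
    swap : ∀ t → Σˢ n (λ top → Σˢ (suc n) λ bot → g (zip (t ∷ top) bot))
                 ≡ Σᵇ λ b → Σᵛ n λ w → g ((t , b) ∷ w)
    swap t = trans (Σˢ-∙ n _ _) (cong₂ _∙_ (Σˢ-zip n _) (Σˢ-zip n _))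

module SumHomomorphism {A B : Set} (_∙_ : Op₂ A) (_◦_ : Op₂ B)
                       (h : A → B) (h-∙ : ∀ x y → h (x ∙ y) ≡ h x ◦ h y) where
  private
    module Source = Sums _∙_
    module Target = Sums _◦_

  Σᶜ-hom : (f : Column → A) → h (Source.Σᶜ f) ≡ Target.Σᶜ (h ∘ f)
  Σᶜ-hom f = trans (h-∙ _ _) (cong₂ _◦_ (h-∙ _ _) (h-∙ _ _))

  Σᵛ-hom : ∀ n (f : Vec Column n → A) → h (Source.Σᵛ n f) ≡ Target.Σᵛ n (h ∘ f)
  Σᵛ-hom zero    f = refl
  Σᵛ-hom (suc n) f = trans (Σᶜ-hom λ c → Source.Σᵛ n (f ∘ (c ∷_)))
                           (Target.Σᶜ-cong λ c → Σᵛ-hom n (f ∘ (c ∷_)))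

module ΣP = Sums (_⊕_ {3})
module Σℕ = Sums _+_

Σᵇ-term-≤ : (f : Bool → ℕ) (t : Bool) → f t ≤ Σℕ.Σᵇ f
Σᵇ-term-≤ f false = m≤m+n _ _
Σᵇ-term-≤ f true  = m≤n+m _ _

Σˢ-term-≤ : ∀ n (f : Subset n → ℕ) (p : Subset n) → f p ≤ Σℕ.Σˢ n f
Σˢ-term-≤ zero    f []      = ≤-refl
Σˢ-term-≤ (suc n) f (t ∷ p) =
  ≤-trans (Σˢ-term-≤ n (f ∘ (t ∷_)) p) (Σᵇ-term-≤ (λ t → Σℕ.Σˢ n (f ∘ (t ∷_))) t)

-- Windows of three consecutive columns

bit : Bool → ℕ
bit false = 0
bit true  = 1

weight : Column → ℕ
weight (t , b) = bit t + bit b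

side : Bool → Column → Bool
side true  = proj₁
side false = proj₂

covered : Bool → Column → Column → Column → Bool
covered s a b c = side s b ∨ side (not s) b ∨ side s a ∨ side s c

dominated : Column → Column → Column → Bool
dominated a b c = covered true a b c ∧ covered false a b c

T-covered : ∀ s a b c → T (covered s a b c) ⇔ (T (side s b) ⊎ T (side (not s) b) ⊎ T (side s a) ⊎ T (side s c))
T-covered s a b c = mk⇔
  (Sum.map₂ (Sum.map₂ (Equivalence.to T-∨) ∘ Equivalence.to T-∨) ∘ Equivalence.to T-∨)
  (Equivalence.from T-∨ ∘ Sum.map₂ (Equivalence.from T-∨ ∘ Sum.map₂ (Equivalence.from T-∨)))

T-dominated : ∀ {a b c} → T (dominated a b c) ⇔ (∀ s → T (covered s a b c))
T-dominated = mk⇔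
  (λ dom → λ { true → proj₁ (Equivalence.to T-∧ dom) ; false → proj₂ (Equivalence.to T-∧ dom) })
  (λ cov → Equivalence.from T-∧ (cov true , cov false))

∀-column? : {P : Column → Set} → (∀ c → Dec (P c)) → Dec (∀ c → P c)
∀-column? P? = map′
  (λ (p₀ , p₁ , p₂ , p₃) → λ { (false , false) → p₀ ; (false , true) → p₁
                            ; (true , false)  → p₂ ; (true , true)  → p₃ })
  (λ p → p _ , p _ , p _ , p _)
  (P? _ ×-dec P? _ ×-dec P? _ ×-dec P? _)

potential : Column → Column → ℕ
potential (true , true) (false , false) = 0
potential _             (false , false) = 1
potential _             _               = 2

excess : Column → Column → Column → ℕ
excess a b c = (2 * weight b + potential b c) ∸ (1 + potential a b)

potential-bound : ∀ a b c → T (dominated a b c) → 1 + potential a b ≤ 2 * weight b + potential b c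
potential-bound = from-yes (∀-column? λ a → ∀-column? λ b → ∀-column? λ c →
                              T? (dominated a b c) →-dec (1 + potential a b ≤? 2 * weight b + potential b c))

excess-balance : ∀ a b c → T (dominated a b c) → excess a b c + (1 + potential a b) ≡ 2 * weight b + potential b c
excess-balance a b c dom = m∸n+n≡m (potential-bound a b c dom)

-- Chains of columns and the transfer matrix

allDominated : Vec Column (2 + m) → Bool
allDominated (a ∷ b ∷ [])    = true
allDominated (a ∷ b ∷ c ∷ r) = dominated a b c ∧ allDominated (b ∷ c ∷ r)

totalExcess : Vec Column (2 + m) → ℕ
totalExcess (a ∷ b ∷ [])    = 0
totalExcess (a ∷ b ∷ c ∷ r) = excess a b c + totalExcess (b ∷ c ∷ r)

innerWeight : Vec Column (2 + m) → ℕ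
innerWeight (a ∷ b ∷ [])    = 0
innerWeight (a ∷ b ∷ c ∷ r) = weight b + innerWeight (b ∷ c ∷ r)

lastPotential : Vec Column (2 + m) → ℕ
lastPotential (a ∷ b ∷ [])    = potential a b
lastPotential (a ∷ b ∷ c ∷ r) = lastPotential (b ∷ c ∷ r)

excess-telescopes : ∀ a b (r : Vec Column m) → T (allDominated (a ∷ b ∷ r)) →
  totalExcess (a ∷ b ∷ r) + (m + potential a b) ≡ 2 * innerWeight (a ∷ b ∷ r) + lastPotential (a ∷ b ∷ r)
excess-telescopes a b []      _   = refl
excess-telescopes a b (c ∷ r) dom =
  add-windows {φ = lastPotential (b ∷ c ∷ r)} {w = weight b} {I = innerWeight (b ∷ c ∷ r)}
              (excess-balance a b c (proj₁ doms)) (excess-telescopes b c r (proj₂ doms))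
  where
  doms : T (dominated a b c) × T (allDominated (b ∷ c ∷ r))
  doms = Equivalence.to T-∧ dom
  add-windows : ∀ {e E k φ₁ φ₂ φ w I} → e + (1 + φ₁) ≡ 2 * w + φ₂ → E + (k + φ₂) ≡ 2 * I + φ →
                (e + E) + (suc k + φ₁) ≡ 2 * (w + I) + φ
  add-windows {e} {E} {k} {φ₁} {φ₂} {φ} {w} {I} first rest = +-cancelʳ-≡ φ₂ _ _ (begin
    (e + E) + (suc k + φ₁) + φ₂       ≡⟨ regroup e E k φ₁ φ₂ ⟩
    (e + (1 + φ₁)) + (E + (k + φ₂))   ≡⟨ cong₂ _+_ first rest ⟩
    (2 * w + φ₂) + (2 * I + φ)        ≡⟨ collect w I φ φ₂ ⟩
    2 * (w + I) + φ + φ₂              ∎)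
    where
    open ≡-Reasoning
    regroup : ∀ e E k φ₁ φ₂ → (e + E) + (suc k + φ₁) + φ₂ ≡ (e + (1 + φ₁)) + (E + (k + φ₂))
    regroup = solve-∀
    collect : ∀ w I φ φ₂ → (2 * w + φ₂) + (2 * I + φ) ≡ 2 * (w + I) + φ + φ₂
    collect = solve-∀

factor : Column → Column → Column → Poly → Poly
factor a b c p = if dominated a b c then shift (excess a b c) p else 𝟘

factor-⊕ : ∀ a b c p q → factor a b c (p ⊕ q) ≡ factor a b c p ⊕ factor a b c q
factor-⊕ a b c p q with dominated a b c
... | true  = shift-⊕ (excess a b c) p q
... | false = refl

pathWeight : Vec Column (2 + m) → Poly
pathWeight (a ∷ b ∷ [])    = x^ 0
pathWeight (a ∷ b ∷ c ∷ r) = factor a b c (pathWeight (b ∷ c ∷ r))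

pathWeight-x^ : (L : Vec Column (2 + m)) → pathWeight L ≡ (if allDominated L then x^ totalExcess L else 𝟘)
pathWeight-x^ (a ∷ b ∷ [])    = refl
pathWeight-x^ (a ∷ b ∷ c ∷ r) with dominated a b c
... | false = refl
... | true  = trans (cong (shift (excess a b c)) (pathWeight-x^ (b ∷ c ∷ r))) (shift-if (allDominated (b ∷ c ∷ r)))
  where
  shift-if : ∀ ok → shift (excess a b c) (if ok then x^ totalExcess (b ∷ c ∷ r) else 𝟘)
                    ≡ (if ok then x^ (excess a b c + totalExcess (b ∷ c ∷ r)) else 𝟘)
  shift-if true  = shift-x^ (excess a b c) _
  shift-if false = shift-𝟘 (excess a b c)

-- Entry a b z₀ z₁ is a generating function for chains that start with columns a b and end with z₀ z₁.
Table : Set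
Table = Column → Column → Column → Column → Poly

transfer : Table → Table
transfer v a b z₀ z₁ = ΣP.Σᶜ λ c → factor a b c (v b c z₀ z₁)

paths : ℕ → Table
paths zero    a b z₀ z₁ = pathWeight (a ∷ b ∷ z₀ ∷ z₁ ∷ [])
paths (suc m) = transfer (paths m)

Σᵛ-pathWeight : ∀ m a b z₀ z₁ →
  ΣP.Σᵛ m (λ r → pathWeight (a ∷ b ∷ r ++ z₀ ∷ z₁ ∷ [])) ≡ paths m a b z₀ z₁
Σᵛ-pathWeight zero    a b z₀ z₁ = refl
Σᵛ-pathWeight (suc m) a b z₀ z₁ = ΣP.Σᶜ-cong λ c → begin
  ΣP.Σᵛ m (λ r → factor a b c (pathWeight (b ∷ c ∷ r ++ z₀ ∷ z₁ ∷ [])))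
    ≡⟨ SumHomomorphism.Σᵛ-hom _⊕_ _⊕_ (factor a b c) (factor-⊕ a b c) m _ ⟨
  factor a b c (ΣP.Σᵛ m (λ r → pathWeight (b ∷ c ∷ r ++ z₀ ∷ z₁ ∷ [])))
    ≡⟨ cong (factor a b c) (Σᵛ-pathWeight m b c z₀ z₁) ⟩
  factor a b c (paths m b c z₀ z₁) ∎
  where open ≡-Reasoning

trace : Table → Poly
trace v = ΣP.Σᶜ λ a → ΣP.Σᶜ λ b → v a b a b

-- Repeating the first two columns at the end turns a cyclic word into a chain whose windows are
-- exactly its n cyclic windows.
closeUp : Vec Column (2 + m) → Vec Column (2 + (m + 2))
closeUp (c₀ ∷ c₁ ∷ r) = c₀ ∷ c₁ ∷ r ++ c₀ ∷ c₁ ∷ []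

Σᵛ-closeUp : ∀ m → ΣP.Σᵛ (2 + m) (pathWeight ∘ closeUp) ≡ trace (paths m)
Σᵛ-closeUp m = ΣP.Σᶜ-cong λ a → ΣP.Σᶜ-cong λ b → Σᵛ-pathWeight m a b a b

lastPotential-++ : ∀ a b (r : Vec Column m) z₀ z₁ →
  lastPotential (a ∷ b ∷ r ++ z₀ ∷ z₁ ∷ []) ≡ potential z₀ z₁
lastPotential-++ a b []      z₀ z₁ = refl
lastPotential-++ a b (c ∷ r) z₀ z₁ = lastPotential-++ b c r z₀ z₁

innerWeight-++ : ∀ a b (r : Vec Column m) z₀ z₁ →
  innerWeight (a ∷ b ∷ r ++ z₀ ∷ z₁ ∷ []) ≡ sum (map weight (b ∷ r ++ z₀ ∷ []))
innerWeight-++ a b []      z₀ z₁ = refl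
innerWeight-++ a b (c ∷ r) z₀ z₁ = cong (weight b +_) (innerWeight-++ b c r z₀ z₁)

closeUp-excess : (w : Vec Column (2 + m)) → T (allDominated (closeUp w)) →
  totalExcess (closeUp w) + (2 + m) ≡ 2 * sum (map weight w)
closeUp-excess {m} w@(c₀ ∷ c₁ ∷ r) dom = +-cancelʳ-≡ φ _ _ (begin
  E + (2 + m) + φ                                     ≡⟨ regroup E m φ ⟩
  E + (m + 2 + φ)                                     ≡⟨ excess-telescopes c₀ c₁ (r ++ c₀ ∷ c₁ ∷ []) dom ⟩
  2 * innerWeight (closeUp w) + lastPotential (closeUp w)
    ≡⟨ cong₂ (λ I φ′ → 2 * I + φ′) (innerWeight-++ c₀ c₁ r c₀ c₁)
                                   (lastPotential-++ c₀ c₁ r c₀ c₁) ⟩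
  2 * (weight c₁ + sum (map weight (r ++ c₀ ∷ []))) + φ
    ≡⟨ cong (λ s → 2 * (weight c₁ + s) + φ) (trans (cong sum (map-++ weight r _)) (sum-++ (map weight r))) ⟩
  2 * (weight c₁ + (sum (map weight r) + (weight c₀ + 0))) + φ
    ≡⟨ rotate (weight c₀) (weight c₁) (sum (map weight r)) φ ⟩
  2 * sum (map weight w) + φ                          ∎)
  where
  open ≡-Reasoning
  E φ : ℕ
  E = totalExcess (closeUp w)
  φ = potential c₀ c₁
  regroup : ∀ E m φ → E + (2 + m) + φ ≡ E + (m + 2 + φ)
  regroup = solve-∀
  rotate : ∀ w₀ w₁ s φ → 2 * (w₁ + (s + (w₀ + 0))) + φ ≡ 2 * (w₀ + (w₁ + s)) + φ
  rotate = solve-∀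

-- Dominating sets as cyclic words

at : Vec Column n → ℕ → Column
at []      _       = (false , false)
at (c ∷ w) zero    = c
at (c ∷ w) (suc j) = at w j

at-toℕ : (w : Vec Column n) (i : Fin n) → at w (toℕ i) ≡ lookup w i
at-toℕ (c ∷ w) fzero    = refl
at-toℕ (c ∷ w) (fsuc i) = at-toℕ w i

at-++ˡ : (xs : Vec Column n) (ys : Vec Column m) {j : ℕ} → j < n → at (xs ++ ys) j ≡ at xs j
at-++ˡ (x ∷ xs) ys {zero}  _         = refl
at-++ˡ (x ∷ xs) ys {suc j} (s≤s j<n) = at-++ˡ xs ys j<n

at-++ʳ : (xs : Vec Column n) (ys : Vec Column m) (j : ℕ) → at (xs ++ ys) (n + j) ≡ at ys j
at-++ʳ []       ys j = refl
at-++ʳ (x ∷ xs) ys j = at-++ʳ xs ys j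

allDominated⇔windows : (L : Vec Column (2 + m)) →
  T (allDominated L) ⇔ (∀ j → j < m → T (dominated (at L j) (at L (1 + j)) (at L (2 + j))))
allDominated⇔windows (a ∷ b ∷ [])    = mk⇔ (λ _ _ ()) (λ _ → tt)
allDominated⇔windows (a ∷ b ∷ c ∷ r) = mk⇔
  (λ dom → λ { zero    _         → proj₁ (Equivalence.to T-∧ dom)
             ; (suc j) (s≤s j<m) →
                 Equivalence.to (allDominated⇔windows (b ∷ c ∷ r)) (proj₂ (Equivalence.to T-∧ dom)) j j<m })
  (λ win → Equivalence.from T-∧
     (win 0 (s≤s z≤n) , Equivalence.from (allDominated⇔windows (b ∷ c ∷ r)) λ j j<m → win (suc j) (s≤s j<m)))

sucMod-of-< : ∀ {j} → suc j < n → sucMod n j ≡ suc j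
sucMod-of-< {n} {j} 1+j<n with suc j ≟ n
... | yes 1+j≡n = ⊥-elim (<-irrefl 1+j≡n 1+j<n)
... | no  _     = refl

sucMod-of-≡ : ∀ {j} → suc j ≡ n → sucMod n j ≡ 0
sucMod-of-≡ {n} {j} 1+j≡n with suc j ≟ n
... | yes _     = refl
... | no  1+j≢n = ⊥-elim (1+j≢n 1+j≡n)

sucMod-cases : ∀ {j} → j < n → (suc j < n × sucMod n j ≡ suc j) ⊎ (suc j ≡ n × sucMod n j ≡ 0)
sucMod-cases j<n with m≤n⇒m<n∨m≡n j<n
... | inj₁ 1+j<n = inj₁ (1+j<n , sucMod-of-< 1+j<n)
... | inj₂ 1+j≡n = inj₂ (1+j≡n , sucMod-of-≡ 1+j≡n)

sucMod-< : ∀ {j} → j < n → sucMod n j < n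
sucMod-< {n} j<n with sucMod-cases j<n
... | inj₁ (1+j<n , eq) = subst (_< n) (sym eq) 1+j<n
... | inj₂ (_     , eq) = subst (_< n) (sym eq) (≤-trans (s≤s z≤n) j<n)

sucMod-injective : ∀ {i j} → i < n → j < n → sucMod n i ≡ sucMod n j → i ≡ j
sucMod-injective i<n j<n eq with sucMod-cases i<n | sucMod-cases j<n
... | inj₁ (_ , eqᵢ) | inj₁ (_ , eqⱼ) = suc-injective (trans (sym eqᵢ) (trans eq eqⱼ))
... | inj₁ (_ , eqᵢ) | inj₂ (_ , eqⱼ) = ⊥-elim (1+n≢0 (trans (sym eqᵢ) (trans eq eqⱼ)))
... | inj₂ (_ , eqᵢ) | inj₁ (_ , eqⱼ) = ⊥-elim (1+n≢0 (trans (sym eqⱼ) (trans (sym eq) eqᵢ)))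
... | inj₂ (eᵢ , _)  | inj₂ (eⱼ , _)  = suc-injective (trans eᵢ (sym eⱼ))

sucMod-surjective : ∀ {i} → i < n → ∃ λ j → j < n × sucMod n j ≡ i
sucMod-surjective {suc n} {zero}  _     = n , ≤-refl , sucMod-of-≡ refl
sucMod-surjective {suc n} {suc i} 1+i<n = i , <-trans (n<1+n i) 1+i<n , sucMod-of-< 1+i<n

CyclicallyDominated : Vec Column n → Set
CyclicallyDominated {n} w = ∀ j → j < n → T (dominated (at w j) (at w (sucMod n j)) (at w (sucMod n (sucMod n j))))

at-closeUp-suc : (w : Vec Column (2 + m)) {j : ℕ} → j < 2 + m → at (closeUp w) (suc j) ≡ at w (sucMod (2 + m) j)
at-closeUp-suc {m} w@(c₀ ∷ c₁ ∷ _) {j} j<n with sucMod-cases j<n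
... | inj₁ (1+j<n , eq) = trans (at-++ˡ w (c₀ ∷ c₁ ∷ []) 1+j<n) (cong (at w) (sym eq))
... | inj₂ (1+j≡n , eq) = begin
  at (closeUp w) (suc j)     ≡⟨ cong (at (closeUp w)) (trans 1+j≡n (sym (+-identityʳ (2 + m)))) ⟩
  at (closeUp w) (2 + m + 0) ≡⟨ at-++ʳ w (c₀ ∷ c₁ ∷ []) 0 ⟩
  c₀                         ≡⟨ cong (at w) (sym eq) ⟩
  at w (sucMod (2 + m) j)    ∎
  where open ≡-Reasoning

at-closeUp-suc² : (w : Vec Column (2 + m)) {j : ℕ} → j < 2 + m →
  at (closeUp w) (suc (suc j)) ≡ at w (sucMod (2 + m) (sucMod (2 + m) j))
at-closeUp-suc² {m} w@(c₀ ∷ c₁ ∷ _) {j} j<n with sucMod-cases j<n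
... | inj₁ (1+j<n , eq) = trans (at-closeUp-suc w 1+j<n) (cong (at w ∘ sucMod (2 + m)) (sym eq))
... | inj₂ (1+j≡n , eq) = begin
  at (closeUp w) (suc (suc j))             ≡⟨ cong (at (closeUp w)) (trans (cong suc 1+j≡n) (+-comm 1 (2 + m))) ⟩
  at (closeUp w) (2 + m + 1)               ≡⟨ at-++ʳ w (c₀ ∷ c₁ ∷ []) 1 ⟩
  c₁                                       ≡⟨ cong (at w ∘ sucMod (2 + m)) (sym eq) ⟩
  at w (sucMod (2 + m) (sucMod (2 + m) j)) ∎
  where open ≡-Reasoning

closeUp⇔cyclic : (w : Vec Column (2 + m)) → T (allDominated (closeUp w)) ⇔ CyclicallyDominated w
closeUp⇔cyclic {m} w@(c₀ ∷ c₁ ∷ _) = mk⇔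
  (λ dom j j<n → subst T (window j<n) (Equivalence.to (allDominated⇔windows (closeUp w)) dom j (resize j<n)))
  (λ cyc → Equivalence.from (allDominated⇔windows (closeUp w)) λ j j<m+2 →
     subst T (sym (window (resize⁻¹ j<m+2))) (cyc j (resize⁻¹ j<m+2)))
  where
  resize : ∀ {j} → j < 2 + m → j < m + 2
  resize {j} = subst (j <_) (+-comm 2 m)
  resize⁻¹ : ∀ {j} → j < m + 2 → j < 2 + m
  resize⁻¹ {j} = subst (j <_) (+-comm m 2)
  window : ∀ {j} → j < 2 + m →
    dominated (at (closeUp w) j) (at (closeUp w) (1 + j)) (at (closeUp w) (2 + j))
    ≡ dominated (at w j) (at w (sucMod (2 + m) j)) (at w (sucMod (2 + m) (sucMod (2 + m) j)))
  window j<n = cong₂ (λ (a , b) c → dominated a b c)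
                     (cong₂ _,_ (at-++ˡ w (c₀ ∷ c₁ ∷ []) j<n) (at-closeUp-suc w j<n)) (at-closeUp-suc² w j<n)

columns : VSet n → Vec Column n
columns (top , bot) = zip top bot

∈⇔T-lookup : (p : Subset n) (i : Fin n) → i ∈ p ⇔ T (lookup p i)
∈⇔T-lookup p i = mk⇔ (Equivalence.from T-≡ ∘ []=⇒lookup) (lookup⇒[]= i p ∘ Equivalence.to T-≡)

∈V⇔side : (S : VSet n) (s : Bool) (i : Fin n) → (s , i) ∈V S ⇔ T (side s (at (columns S) (toℕ i)))
∈V⇔side (top , bot) true  i rewrite at-toℕ (zip top bot) i | lookup-zip i top bot = ∈⇔T-lookup top i
∈V⇔side (top , bot) false i rewrite at-toℕ (zip top bot) i | lookup-zip i top bot = ∈⇔T-lookup bot i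

Dominates : (n : ℕ) → VSet n → Vertex n → Set
Dominates n S v = v ∈V S ⊎ ∃ λ u → Adj n u v × u ∈V S

module _ {n} (S : VSet n) where
  private
    w : Vec Column n
    w = columns S
    ∈⇒side : ∀ {s i} → (s , i) ∈V S → T (side s (at w (toℕ i)))
    ∈⇒side = Equivalence.to (∈V⇔side S _ _)
    side⇒∈ : ∀ {s i} → T (side s (at w (toℕ i))) → (s , i) ∈V S
    side⇒∈ = Equivalence.from (∈V⇔side S _ _)

  dominates⇔covered : ∀ s i {j} → j < n → toℕ i ≡ sucMod n j →
    Dominates n S (s , i) ⇔ T (covered s (at w j) (at w (toℕ i)) (at w (sucMod n (toℕ i))))
  dominates⇔covered s i {j} j<n i≡j⁺ =
    ⇔.trans (mk⇔ to from) (⇔.sym (T-covered s (at w j) (at w (toℕ i)) (at w (sucMod n (toℕ i)))))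
    where
    atSide : Bool → ℕ → Set
    atSide s′ k = T (side s′ (at w k))

    Around : Set
    Around = atSide s (toℕ i) ⊎ atSide (not s) (toℕ i) ⊎ atSide s j ⊎ atSide s (sucMod n (toℕ i))

    to : Dominates n S (s , i) → Around
    to (inj₁ i∈S) = inj₁ (∈⇒side i∈S)
    to (inj₂ ((s′ , k) , inj₂ (s≡¬s′ , refl) , k∈S)) = inj₂ (inj₁
      (subst (λ s″ → atSide s″ (toℕ i)) (trans (sym (not-involutive s′)) (cong not (sym s≡¬s′)))
             (∈⇒side k∈S)))
    to (inj₂ ((s′ , k) , inj₁ (refl , inj₁ i≡k⁺) , k∈S)) = inj₂ (inj₂ (inj₁
      (subst (atSide s) (sucMod-injective (toℕ<n k) j<n (trans (sym i≡k⁺) i≡j⁺)) (∈⇒side k∈S))))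
    to (inj₂ ((s′ , k) , inj₁ (refl , inj₂ k≡i⁺) , k∈S)) = inj₂ (inj₂ (inj₂
      (subst (atSide s) k≡i⁺ (∈⇒side k∈S))))

    from : Around → Dominates n S (s , i)
    from (inj₁ here) = inj₁ (side⇒∈ here)
    from (inj₂ (inj₁ across)) = inj₂ ((not s , i) , inj₂ (sym (not-involutive s) , refl) , side⇒∈ across)
    from (inj₂ (inj₂ (inj₁ left))) =
      inj₂ ((s , fromℕ< j<n) , inj₁ (refl , inj₁ (trans i≡j⁺ (cong (sucMod n) (sym (toℕ-fromℕ< j<n)))))
           , side⇒∈ (subst (atSide s) (sym (toℕ-fromℕ< j<n)) left))
    from (inj₂ (inj₂ (inj₂ right))) =
      inj₂ ((s , fromℕ< i⁺<n) , inj₁ (refl , inj₂ (toℕ-fromℕ< i⁺<n))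
           , side⇒∈ (subst (atSide s) (sym (toℕ-fromℕ< i⁺<n)) right))
      where
      i⁺<n : sucMod n (toℕ i) < n
      i⁺<n = sucMod-< (toℕ<n i)

  dominating⇔cyclic : Dominating n S ⇔ CyclicallyDominated w
  dominating⇔cyclic = mk⇔ to from
    where
    coveredAround : Bool → ℕ → ℕ → Set
    coveredAround s j k = T (covered s (at w j) (at w k) (at w (sucMod n k)))

    to : Dominating n S → CyclicallyDominated w
    to dom j j<n = Equivalence.from T-dominated λ s →
      subst (coveredAround s j) centre≡
            (Equivalence.to (dominates⇔covered s centre j<n centre≡) (dom (s , centre)))
      where
      centre : Fin n
      centre = fromℕ< (sucMod-< j<n)
      centre≡ : toℕ centre ≡ sucMod n j
      centre≡ = toℕ-fromℕ< (sucMod-< j<n)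

    from : CyclicallyDominated w → Dominating n S
    from cyc (s , i) with sucMod-surjective (toℕ<n i)
    ... | j , j<n , j⁺≡i = Equivalence.from (dominates⇔covered s i j<n (sym j⁺≡i))
      (subst (coveredAround s j) j⁺≡i (Equivalence.to T-dominated (cyc j j<n) s))

dominating⇔closed : (S : VSet (2 + m)) → Dominating (2 + m) S ⇔ T (allDominated (closeUp (columns S)))
dominating⇔closed S = ⇔.trans (dominating⇔cyclic S) (⇔.sym (closeUp⇔cyclic (columns S)))

weight-columns : (S : VSet n) → sum (map weight (columns S)) ≡ size S
weight-columns ([] , [])           = refl
weight-columns (t ∷ top , b ∷ bot) = begin
  bit t + bit b + sum (map weight (zip top bot)) ≡⟨ cong (bit t + bit b +_) (weight-columns (top , bot)) ⟩
  bit t + bit b + (∣ top ∣ + ∣ bot ∣)           ≡⟨ interchange (bit t) (bit b) ∣ top ∣ ∣ bot ∣ ⟩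
  (bit t + ∣ top ∣) + (bit b + ∣ bot ∣)         ≡⟨ cong₂ _+_ (∣∷∣ t top) (∣∷∣ b bot) ⟩
  ∣ t ∷ top ∣ + ∣ b ∷ bot ∣                     ∎
  where
  open ≡-Reasoning
  interchange : ∀ a b c d → a + b + (c + d) ≡ (a + c) + (b + d)
  interchange = solve-∀
  ∣∷∣ : ∀ {k} x (p : Subset k) → bit x + ∣ p ∣ ≡ ∣ x ∷ p ∣
  ∣∷∣ false p = refl
  ∣∷∣ true  p = refl

cyclicWeight : VSet (2 + m) → Poly
cyclicWeight S = pathWeight (closeUp (columns S))

cyclicWeight-dominating : (S : VSet (2 + m)) → Dominating (2 + m) S →
  ∃ λ E → cyclicWeight S ≡ x^ E × E + (2 + m) ≡ 2 * size S
cyclicWeight-dominating S dom =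
  totalExcess (closeUp (columns S)) ,
  trans (pathWeight-x^ (closeUp (columns S)))
        (cong (λ ok → if ok then x^ totalExcess (closeUp (columns S)) else 𝟘) (Equivalence.to T-≡ closed)) ,
  trans (closeUp-excess (columns S) closed) (cong (2 *_) (weight-columns S))
  where
  closed : T (allDominated (closeUp (columns S)))
  closed = Equivalence.to (dominating⇔closed S) dom

cyclicWeight-non-dominating : (S : VSet (2 + m)) → ¬ Dominating (2 + m) S → cyclicWeight S ≡ 𝟘
cyclicWeight-non-dominating S ¬dom with allDominated (closeUp (columns S)) in closed
... | true  = ⊥-elim (¬dom (Equivalence.from (dominating⇔closed S) (Equivalence.from T-≡ closed)))
... | false = trans (pathWeight-x^ (closeUp (columns S)))
                    (cong (λ ok → if ok then x^ totalExcess (closeUp (columns S)) else 𝟘) closed)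

length-filter : {A : Set} {P : A → Set} (P? : Decidable P) (xs : List A) →
  List.length (List.filter P? xs) ≡ sumˡ (List.map (bit ∘ does ∘ P?) xs)
length-filter P? []       = refl
length-filter P? (x ∷ xs) with P? x
... | yes _ = cong suc (length-filter P? xs)
... | no  _ = length-filter P? xs

filter-nonempty : {A : Set} {P : A → Set} (P? : Decidable P) (xs : List A) →
  0 < List.length (List.filter P? xs) → ∃ P
filter-nonempty P? xs pos with List.filter P? xs | all-filter P? xs
filter-nonempty P? xs () | []    | []
filter-nonempty P? xs _  | y ∷ _ | py ∷ _ = y , py

sum-map-++ : {A : Set} (f : A → ℕ) (xs ys : List A) →
  sumˡ (List.map f (xs List.++ ys)) ≡ sumˡ (List.map f xs) + sumˡ (List.map f ys)
sum-map-++ f xs ys = trans (cong sumˡ (List.map-++ f xs ys)) (sumˡ-++ (List.map f xs) _)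

sum-allSubsets : ∀ n (f : Subset n → ℕ) → sumˡ (List.map f (allSubsets n)) ≡ Σℕ.Σˢ n f
sum-allSubsets zero    f = +-identityʳ (f [])
sum-allSubsets (suc n) f =
  trans (sum-map-++ f (List.map (false ∷_) (allSubsets n)) _) (cong₂ _+_ (half false) (half true))
  where
  half : ∀ t → sumˡ (List.map f (List.map (t ∷_) (allSubsets n))) ≡ Σℕ.Σˢ n (f ∘ (t ∷_))
  half t = trans (cong sumˡ (sym (List.map-∘ (allSubsets n)))) (sum-allSubsets n (f ∘ (t ∷_)))

sum-allVSets : ∀ n (g : VSet n → ℕ) →
  sumˡ (List.map g (allVSets n)) ≡ Σℕ.Σˢ n λ top → Σℕ.Σˢ n λ bot → g (top , bot)
sum-allVSets n g =
  trans (sum-concatMap (allSubsets n)) (trans (cong sumˡ (List.map-cong row (allSubsets n))) (sum-allSubsets n _))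
  where
  row : ∀ top → sumˡ (List.map g (List.map (top ,_) (allSubsets n))) ≡ Σℕ.Σˢ n λ bot → g (top , bot)
  row top = trans (cong sumˡ (sym (List.map-∘ (allSubsets n)))) (sum-allSubsets n _)
  sum-concatMap : ∀ tops →
    sumˡ (List.map g (List.concatMap (λ top → List.map (top ,_) (allSubsets n)) tops))
    ≡ sumˡ (List.map (λ top → sumˡ (List.map g (List.map (top ,_) (allSubsets n)))) tops)
  sum-concatMap []           = refl
  sum-concatMap (top ∷ tops) =
    trans (sum-map-++ g (List.map (top ,_) (allSubsets n)) _) (cong (_ +_) (sum-concatMap tops))

coefficient-trace : ∀ m (i : Fin 3) →
  lookup (trace (paths m)) i
  ≡ Σℕ.Σˢ (2 + m) λ top → Σℕ.Σˢ (2 + m) λ bot → lookup (cyclicWeight (top , bot)) i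
coefficient-trace m i = begin
  lookup (trace (paths m)) i
    ≡⟨ cong (λ p → lookup p i) (Σᵛ-closeUp m) ⟨
  lookup (ΣP.Σᵛ (2 + m) (pathWeight ∘ closeUp)) i
    ≡⟨ SumHomomorphism.Σᵛ-hom _⊕_ _+_ (λ p → lookup p i) (lookup-zipWith _+_ i)
                              (2 + m) (pathWeight ∘ closeUp) ⟩
  Σℕ.Σᵛ (2 + m) (λ w → lookup (pathWeight (closeUp w)) i)
    ≡⟨ SumLaws.Σˢ-zip +-isCommutativeSemigroup (2 + m) (λ w → lookup (pathWeight (closeUp w)) i) ⟨
  Σℕ.Σˢ (2 + m) (λ top → Σℕ.Σˢ (2 + m) λ bot → lookup (cyclicWeight (top , bot)) i) ∎
  where open ≡-Reasoning

excess≡2⇔size≡k : ∀ {m k s E} → 2 * k ≡ 2 + m + 2 → E + (2 + m) ≡ 2 * s → E ≡ 2 ⇔ s ≡ k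
excess≡2⇔size≡k {m} {k} {s} {E} 2k≡n+2 E+n≡2s = mk⇔
  (λ { refl → *-cancelˡ-≡ s k 2 (trans (sym E+n≡2s) (trans (+-comm 2 (2 + m)) (sym 2k≡n+2))) })
  (λ { refl → +-cancelʳ-≡ (2 + m) E 2 (trans E+n≡2s (trans 2k≡n+2 (+-comm (2 + m) 2))) })

indicator≡coefficient : ∀ {m k} → 2 * k ≡ 2 + m + 2 → (S : VSet (2 + m)) →
  bit (does (Dominating? (2 + m) S ×-dec size S ≟ k)) ≡ lookup (cyclicWeight S) (# 2)
indicator≡coefficient {m} {k} 2k≡n+2 S with Dominating? (2 + m) S
... | no ¬dom = sym (cong (λ p → lookup p (# 2)) (cyclicWeight-non-dominating S ¬dom))
... | yes dom with cyclicWeight-dominating S dom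
...   | E , weight≡x^E , E+n≡2s = trans (indicator (size S ≟ k)) (sym (cong (λ p → lookup p (# 2)) weight≡x^E))
  where
  size⇔ : E ≡ 2 ⇔ size S ≡ k
  size⇔ = excess≡2⇔size≡k 2k≡n+2 E+n≡2s
  indicator : (d : Dec (size S ≡ k)) → bit (does (yes dom ×-dec d)) ≡ lookup (x^_ {3} E) (# 2)
  indicator (yes size≡k) = sym (subst (λ e → lookup (x^_ {3} e) (# 2) ≡ 1) (sym (Equivalence.from size⇔ size≡k))
                                      (lookup-x^-toℕ {d = 3} (# 2)))
  indicator (no  size≢k) = sym (lookup-x^-≢ (# 2) (size≢k ∘ Equivalence.to size⇔ ∘ sym))

numDomSetsOfSize≡coefficient : ∀ {m k} → 2 * k ≡ 2 + m + 2 →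
  numDomSetsOfSize (2 + m) k ≡ lookup (trace (paths m)) (# 2)
numDomSetsOfSize≡coefficient {m} {k} 2k≡n+2 = begin
  numDomSetsOfSize (2 + m) k
    ≡⟨ length-filter _ (allVSets (2 + m)) ⟩
  sumˡ (List.map (bit ∘ does ∘ λ S → Dominating? (2 + m) S ×-dec size S ≟ k) (allVSets (2 + m)))
    ≡⟨ sum-allVSets (2 + m) _ ⟩
  Σℕ.Σˢ (2 + m) (λ top → Σℕ.Σˢ (2 + m) λ bot →
    bit (does (Dominating? (2 + m) (top , bot) ×-dec size {2 + m} (top , bot) ≟ k)))
    ≡⟨ Σℕ.Σˢ-cong (2 + m) (λ top → Σℕ.Σˢ-cong (2 + m) λ bot →
         indicator≡coefficient {k = k} 2k≡n+2 (top , bot)) ⟩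
  Σℕ.Σˢ (2 + m) (λ top → Σℕ.Σˢ (2 + m) λ bot → lookup (cyclicWeight (top , bot)) (# 2))
    ≡⟨ coefficient-trace m (# 2) ⟨
  lookup (trace (paths m)) (# 2) ∎
  where open ≡-Reasoning

size-lower-bound : ∀ {m k} → 2 * k ≡ 2 + m + 2 →
  lookup (trace (paths m)) (# 0) ≡ 0 → lookup (trace (paths m)) (# 1) ≡ 0 →
  (S : VSet (2 + m)) → Dominating (2 + m) S → k ≤ size S
size-lower-bound {m} {k} 2k≡n+2 c₀≡0 c₁≡0 S@(top , bot) dom with cyclicWeight-dominating S dom
... | E , weight≡x^E , E+n≡2s = *-cancelˡ-≤ 2 (begin
  2 * k        ≡⟨ trans 2k≡n+2 (+-comm (2 + m) 2) ⟩
  2 + (2 + m)  ≤⟨ +-monoˡ-≤ (2 + m) (two≤E (vanishes (# 0) c₀≡0) (vanishes (# 1) c₁≡0)) ⟩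
  E + (2 + m)  ≡⟨ E+n≡2s ⟩
  2 * size S   ∎)
  where
  open ≤-Reasoning
  vanishes : ∀ i → lookup (trace (paths m)) i ≡ 0 → lookup (x^_ {3} E) i ≡ 0
  vanishes i cᵢ≡0 = n≤0⇒n≡0 (begin
    lookup (x^ E) i ≡⟨ cong (λ p → lookup p i) weight≡x^E ⟨
    lookup (cyclicWeight S) i
      ≤⟨ Σˢ-term-≤ (2 + m) (λ bot → lookup (cyclicWeight (top , bot)) i) bot ⟩
    Σℕ.Σˢ (2 + m) (λ bot → lookup (cyclicWeight (top , bot)) i)
      ≤⟨ Σˢ-term-≤ (2 + m) (λ top → Σℕ.Σˢ (2 + m) λ bot → lookup (cyclicWeight (top , bot)) i) top ⟩
    Σℕ.Σˢ (2 + m) (λ top → Σℕ.Σˢ (2 + m) λ bot → lookup (cyclicWeight (top , bot)) i)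
      ≡⟨ coefficient-trace m i ⟨
    lookup (trace (paths m)) i ≡⟨ cᵢ≡0 ⟩
    0 ∎)
  two≤E : ∀ {E} → lookup (x^_ {3} E) (# 0) ≡ 0 → lookup (x^_ {3} E) (# 1) ≡ 0 → 2 ≤ E
  two≤E {0}           ()
  two≤E {1}           _ ()
  two≤E {suc (suc _)} _ _ = s≤s (s≤s z≤n)

zeta-from-trace : ∀ {m k z} → 2 * k ≡ 2 + m + 2 → trace (paths m) ≡ 0 ∷ 0 ∷ z ∷ [] → 0 < z →
                  IsZeta (2 + m) z
zeta-from-trace {m} {k} {z} 2k≡n+2 trace≡ 0<z =
  k , (minimum , size-lower-bound 2k≡n+2 (coefficient (# 0)) (coefficient (# 1))) , count
  where
  coefficient : ∀ i → lookup (trace (paths m)) i ≡ lookup (0 ∷ 0 ∷ z ∷ []) i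
  coefficient i = cong (λ p → lookup p i) trace≡
  count : numDomSetsOfSize (2 + m) k ≡ z
  count = trans (numDomSetsOfSize≡coefficient 2k≡n+2) (coefficient (# 2))
  minimum : ∃ λ S → Dominating (2 + m) S × size S ≡ k
  minimum = filter-nonempty (λ S → Dominating? (2 + m) S ×-dec size S ≟ k) (allVSets (2 + m))
                            (subst (0 <_) (sym count) 0<z)

-- Four transfer steps as a Jordan block

_≈ᵀ_ : Table → Table → Set
v ≈ᵀ v′ = ∀ a b z₀ z₁ → v a b z₀ z₁ ≡ v′ a b z₀ z₁

_≟ᵀ_ : (v v′ : Table) → Dec (v ≈ᵀ v′)
v ≟ᵀ v′ = ∀-column? λ a → ∀-column? λ b → ∀-column? λ z₀ → ∀-column? λ z₁ →
  ≡-dec _≟_ (v a b z₀ z₁) (v′ a b z₀ z₁)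

≈ᵀ-trans : ∀ {u v w} → u ≈ᵀ v → v ≈ᵀ w → u ≈ᵀ w
≈ᵀ-trans u≈v v≈w a b z₀ z₁ = trans (u≈v a b z₀ z₁) (v≈w a b z₀ z₁)

_⊞_ : Table → Table → Table
(v ⊞ v′) a b z₀ z₁ = v a b z₀ z₁ ⊕ v′ a b z₀ z₁

⊞-cong : ∀ {u u′ v v′} → u ≈ᵀ u′ → v ≈ᵀ v′ → (u ⊞ v) ≈ᵀ (u′ ⊞ v′)
⊞-cong u≈u′ v≈v′ a b z₀ z₁ = cong₂ _⊕_ (u≈u′ a b z₀ z₁) (v≈v′ a b z₀ z₁)

transfer-cong : ∀ {v v′} → v ≈ᵀ v′ → transfer v ≈ᵀ transfer v′
transfer-cong v≈v′ a b z₀ z₁ = ΣP.Σᶜ-cong λ c → cong (factor a b c) (v≈v′ b c z₀ z₁)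

transfer-⊞ : ∀ v v′ → transfer (v ⊞ v′) ≈ᵀ (transfer v ⊞ transfer v′)
transfer-⊞ v v′ a b z₀ z₁ =
  trans (ΣP.Σᶜ-cong λ c → factor-⊕ a b c (v b c z₀ z₁) (v′ b c z₀ z₁))
        (SumLaws.Σᶜ-∙ ⊕-isCommutativeSemigroup (λ c → factor a b c (v b c z₀ z₁))
                                              (λ c → factor a b c (v′ b c z₀ z₁)))

-- Four steps at a time, since the theorem concerns a single residue class of n modulo 4.
jump : Table → Table
jump v = transfer (transfer (transfer (transfer v)))

jump-cong : ∀ {v v′} → v ≈ᵀ v′ → jump v ≈ᵀ jump v′
jump-cong = transfer-cong ∘ transfer-cong ∘ transfer-cong ∘ transfer-cong

jump-⊞ : ∀ v v′ → jump (v ⊞ v′) ≈ᵀ (jump v ⊞ jump v′)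
jump-⊞ v v′ =
  ≈ᵀ-trans (transfer-cong (transfer-cong (transfer-cong (transfer-⊞ v v′))))
  (≈ᵀ-trans (transfer-cong (transfer-cong (transfer-⊞ (transfer v) (transfer v′))))
  (≈ᵀ-trans (transfer-cong (transfer-⊞ (transfer (transfer v)) (transfer (transfer v′))))
            (transfer-⊞ (transfer (transfer (transfer v))) (transfer (transfer (transfer v′))))))

trace-cong : ∀ {v v′} → v ≈ᵀ v′ → trace v ≡ trace v′
trace-cong v≈v′ = ΣP.Σᶜ-cong λ a → ΣP.Σᶜ-cong λ b → v≈v′ a b a b

trace-⊞ : ∀ v v′ → trace (v ⊞ v′) ≡ trace v ⊕ trace v′
trace-⊞ v v′ =
  trans (ΣP.Σᶜ-cong λ a → SumLaws.Σᶜ-∙ ⊕-isCommutativeSemigroup (λ b → v a b a b) (λ b → v′ a b a b))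
        (SumLaws.Σᶜ-∙ ⊕-isCommutativeSemigroup (λ a → ΣP.Σᶜ λ b → v a b a b)
                                              (λ a → ΣP.Σᶜ λ b → v′ a b a b))

module JordanChain (P Q R : Table) (jump-P : jump P ≈ᵀ (P ⊞ Q)) (jump-Q : jump Q ≈ᵀ (Q ⊞ R))
                   (jump-R : jump R ≈ᵀ R) where

  Qs : ℕ → Table
  Qs zero    = Q
  Qs (suc u) = Qs u ⊞ R

  Ps : ℕ → Table
  Ps zero    = P
  Ps (suc u) = Ps u ⊞ Qs u

  jump-Qs : ∀ u → jump (Qs u) ≈ᵀ (Qs u ⊞ R)
  jump-Qs zero    = jump-Q
  jump-Qs (suc u) = ≈ᵀ-trans (jump-⊞ (Qs u) R) (⊞-cong (jump-Qs u) jump-R)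

  jump-Ps : ∀ u → jump (Ps u) ≈ᵀ (Ps u ⊞ Qs u)
  jump-Ps zero    = jump-P
  jump-Ps (suc u) = ≈ᵀ-trans (jump-⊞ (Ps u) (Qs u)) (⊞-cong (jump-Ps u) (jump-Qs u))

  module _ {q r : ℕ} (trace-Q : trace Q ≡ 0 ∷ 0 ∷ q ∷ []) (trace-R : trace R ≡ 0 ∷ 0 ∷ r ∷ []) where

    trace-Qs : ∀ u → trace (Qs u) ≡ 0 ∷ 0 ∷ q + u * r ∷ []
    trace-Qs zero    = trans trace-Q (cong (λ c → 0 ∷ 0 ∷ c ∷ []) (sym (+-identityʳ q)))
    trace-Qs (suc u) = begin
      trace (Qs u ⊞ R)              ≡⟨ trace-⊞ (Qs u) R ⟩
      trace (Qs u) ⊕ trace R        ≡⟨ cong₂ _⊕_ (trace-Qs u) trace-R ⟩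
      0 ∷ 0 ∷ q + u * r + r ∷ []    ≡⟨ cong (λ c → 0 ∷ 0 ∷ c ∷ []) (linear-step q u r) ⟩
      0 ∷ 0 ∷ q + suc u * r ∷ []    ∎
      where
      open ≡-Reasoning
      linear-step : ∀ q u r → q + u * r + r ≡ q + suc u * r
      linear-step = solve-∀

    trace-Ps : (f : ℕ → ℕ) → trace P ≡ 0 ∷ 0 ∷ f 0 ∷ [] → (∀ u → f u + (q + u * r) ≡ f (suc u)) →
               ∀ u → trace (Ps u) ≡ 0 ∷ 0 ∷ f u ∷ []
    trace-Ps f trace-P f-step zero    = trace-P
    trace-Ps f trace-P f-step (suc u) = begin
      trace (Ps u ⊞ Qs u)                ≡⟨ trace-⊞ (Ps u) (Qs u) ⟩
      trace (Ps u) ⊕ trace (Qs u)        ≡⟨ cong₂ _⊕_ (trace-Ps f trace-P f-step u) (trace-Qs u) ⟩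
      0 ∷ 0 ∷ f u + (q + u * r) ∷ []     ≡⟨ cong (λ c → 0 ∷ 0 ∷ c ∷ []) (f-step u) ⟩
      0 ∷ 0 ∷ f (suc u) ∷ []             ∎
      where open ≡-Reasoning

-- Tables are memoised as vectors so that evaluating one transfer step after another shares entries
-- instead of recomputing them.

tabulateᶜ : {A : Set} → (Column → A) → Vec A 4
tabulateᶜ f = f (false , false) ∷ f (false , true) ∷ f (true , false) ∷ f (true , true) ∷ []

lookupᶜ : {A : Set} → Vec A 4 → Column → A
lookupᶜ (x ∷ _ ∷ _ ∷ _ ∷ []) (false , false) = x
lookupᶜ (_ ∷ x ∷ _ ∷ _ ∷ []) (false , true)  = x
lookupᶜ (_ ∷ _ ∷ x ∷ _ ∷ []) (true  , false) = x
lookupᶜ (_ ∷ _ ∷ _ ∷ x ∷ []) (true  , true)  = x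

lookupᶜ-tabulateᶜ : {A : Set} (f : Column → A) → lookupᶜ (tabulateᶜ f) ≗ f
lookupᶜ-tabulateᶜ f (false , false) = refl
lookupᶜ-tabulateᶜ f (false , true)  = refl
lookupᶜ-tabulateᶜ f (true  , false) = refl
lookupᶜ-tabulateᶜ f (true  , true)  = refl

Memo : Set
Memo = Vec (Vec (Vec (Vec Poly 4) 4) 4) 4

memo : Table → Memo
memo v = tabulateᶜ λ a → tabulateᶜ λ b → tabulateᶜ λ z₀ → tabulateᶜ λ z₁ → v a b z₀ z₁

recall : Memo → Table
recall t a b z₀ z₁ = lookupᶜ (lookupᶜ (lookupᶜ (lookupᶜ t a) b) z₀) z₁

recall-memo : ∀ v → recall (memo v) ≈ᵀ v
recall-memo v a b z₀ z₁ = begin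
  recall (memo v) a b z₀ z₁
    ≡⟨ cong (λ t → lookupᶜ (lookupᶜ (lookupᶜ t b) z₀) z₁)
            (lookupᶜ-tabulateᶜ (λ a → tabulateᶜ λ b → tabulateᶜ λ z₀ → tabulateᶜ (v a b z₀)) a) ⟩
  lookupᶜ (lookupᶜ (lookupᶜ (tabulateᶜ λ b → tabulateᶜ λ z₀ → tabulateᶜ (v a b z₀)) b) z₀) z₁
    ≡⟨ cong (λ t → lookupᶜ (lookupᶜ t z₀) z₁)
            (lookupᶜ-tabulateᶜ (λ b → tabulateᶜ λ z₀ → tabulateᶜ (v a b z₀)) b) ⟩
  lookupᶜ (lookupᶜ (tabulateᶜ λ z₀ → tabulateᶜ (v a b z₀)) z₀) z₁
    ≡⟨ cong (λ t → lookupᶜ t z₁) (lookupᶜ-tabulateᶜ (λ z₀ → tabulateᶜ (v a b z₀)) z₀) ⟩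
  lookupᶜ (tabulateᶜ (v a b z₀)) z₁
    ≡⟨ lookupᶜ-tabulateᶜ (v a b z₀) z₁ ⟩
  v a b z₀ z₁ ∎
  where open ≡-Reasoning

pathsMemo : ℕ → Memo
pathsMemo zero    = memo (paths 0)
pathsMemo (suc m) = memo (transfer (recall (pathsMemo m)))

paths≈pathsMemo : ∀ m → paths m ≈ᵀ recall (pathsMemo m)
paths≈pathsMemo zero    a b z₀ z₁ = sym (recall-memo (paths 0) a b z₀ z₁)
paths≈pathsMemo (suc m) a b z₀ z₁ =
  trans (transfer-cong (paths≈pathsMemo m) a b z₀ z₁)
        (sym (recall-memo (transfer (recall (pathsMemo m))) a b z₀ z₁))

-- Truncated subtraction is harmless here: the certificate below re-checks P₀ ⊞ Q₀ and Q₀ ⊞ R₀.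
difference : Memo → Memo
difference t = memo λ a b z₀ z₁ → zipWith _∸_ (jump (recall t) a b z₀ z₁) (recall t a b z₀ z₁)

P₀ Q₀ R₀ : Memo
P₀ = pathsMemo 8
Q₀ = difference P₀
R₀ = difference Q₀

IsJordanChain : Memo → Memo → Memo → Set
IsJordanChain p q r =
  jump (recall p) ≈ᵀ (recall p ⊞ recall q) ×
  jump (recall q) ≈ᵀ (recall q ⊞ recall r) ×
  jump (recall r) ≈ᵀ recall r

isJordanChain? : ∀ p q r → Dec (IsJordanChain p q r)
isJordanChain? p q r = (jump (recall p) ≟ᵀ (recall p ⊞ recall q))
                 ×-dec (jump (recall q) ≟ᵀ (recall q ⊞ recall r))
                 ×-dec (jump (recall r) ≟ᵀ recall r)

-- Decided rather than proved by refl: a decision procedure is evaluated in one run that shares the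
-- memoised tables, while checking refl re-evaluates them for every coefficient compared.
P₀-Q₀-R₀-isJordanChain : IsJordanChain P₀ Q₀ R₀
P₀-Q₀-R₀-isJordanChain = from-yes (isJordanChain? P₀ Q₀ R₀)

open JordanChain (recall P₀) (recall Q₀) (recall R₀) (proj₁ P₀-Q₀-R₀-isJordanChain)
                 (proj₁ (proj₂ P₀-Q₀-R₀-isJordanChain)) (proj₂ (proj₂ P₀-Q₀-R₀-isJordanChain))

paths≈Ps : ∀ u → paths (u * 4 + 8) ≈ᵀ Ps u
paths≈Ps zero    = paths≈pathsMemo 8
paths≈Ps (suc u) = ≈ᵀ-trans (jump-cong (paths≈Ps u)) (jump-Ps u)

rungs : ℕ → ℕ
rungs u = 2 + (u * 4 + 8)

trace-paths : ∀ u → trace (paths (u * 4 + 8)) ≡ 0 ∷ 0 ∷ rungs u * (rungs u + 2) ∷ []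
trace-paths u = trans (trace-cong (paths≈Ps u))
  (trace-Ps trace-Q₀ trace-R₀ (λ u → rungs u * (rungs u + 2)) trace-P₀ quadratic-step u)
  where
  trace-P₀ : trace (recall P₀) ≡ 0 ∷ 0 ∷ 120 ∷ []
  trace-P₀ = from-yes (≡-dec _≟_ (trace (recall P₀)) (0 ∷ 0 ∷ 120 ∷ []))
  trace-Q₀ : trace (recall Q₀) ≡ 0 ∷ 0 ∷ 104 ∷ []
  trace-Q₀ = from-yes (≡-dec _≟_ (trace (recall Q₀)) (0 ∷ 0 ∷ 104 ∷ []))
  trace-R₀ : trace (recall R₀) ≡ 0 ∷ 0 ∷ 32 ∷ []
  trace-R₀ = from-yes (≡-dec _≟_ (trace (recall R₀)) (0 ∷ 0 ∷ 32 ∷ []))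
  quadratic-step : ∀ u → (2 + (u * 4 + 8)) * (2 + (u * 4 + 8) + 2) + (104 + u * 32)
                         ≡ (2 + (suc u * 4 + 8)) * (2 + (suc u * 4 + 8) + 2)
  quadratic-step = solve-∀

theorem3p13 : ∀ (t : ℕ) → 10 ≤ 4 * t + 2 → IsZeta (4 * t + 2) ((4 * t + 2) * ((4 * t + 2) + 2))
theorem3p13 0             (s≤s (s≤s ()))
theorem3p13 1             (s≤s (s≤s (s≤s (s≤s (s≤s (s≤s ()))))))
theorem3p13 (suc (suc u)) _ =
  subst (λ n → IsZeta n (n * (n + 2))) (n≡4t+2 u)
        (zeta-from-trace {k = u * 2 + 6} (2k≡n+2 u) (trace-paths u) (s≤s z≤n))
  where
  n≡4t+2 : ∀ u → 2 + (u * 4 + 8) ≡ 4 * suc (suc u) + 2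
  n≡4t+2 = solve-∀
  2k≡n+2 : ∀ u → 2 * (u * 2 + 6) ≡ 2 + (u * 4 + 8) + 2
  2k≡n+2 = solve-∀
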